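{- Let $G$ be a graph of order $n\geq 4$ and let $\overline{G}$ be the reduced graph of $G$. Then $$m_{L(G)}(1)=p(G)-q(G)+m_{L(\overline{G})}(1).$$
   Context: All graphs are finite, simple and undirected. $L(G)=D(G)-A(G)$ is the Laplacian matrix of $G$ ($D(G)$ the diagonal degree matrix, $A(G)$ the adjacency matrix), and $m_{L(G)}(1)$ denotes the multiplicity of $1$ as an eigenvalue of $L(G)$. A pendant vertex is a vertex of degree $1$; a quasi-pendant vertex is a vertex adjacent to a pendant vertex. $p(G)$ and $q(G)$ denote the numbers of pendant and quasi-pendant vertices of $G$. A graph $G$ is called reduced if $p(G)=q(G)$. The reduced graph $\overline{G}$ of $G$ is obtained from $G$ by deleting pendant vertices until each quasi-pendant vertex is adjacent to exactly one pendant vertex (so that $p(\overline{G})=q(\overline{G})$). -}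

module Defs where

open import Data.Bool using (Bool; true; false; if_then_else_; _∧_; _∨_)
open import Data.Nat using (ℕ; zero; suc; _≡ᵇ_) renaming (_+_ to _+ℕ_)
open import Data.Fin using (Fin; zero; suc; _≟_)
open import Data.Integer using (+_)
open import Data.Rational using (ℚ; 0ℚ; 1ℚ; -_; _+_; _*_; _/_)
open import Data.Product using (Σ; ∃; _×_)
open import Relation.Binary.PropositionalEquality using (_≡_)
open import Relation.Nullary using (¬_; does)
open import Function.Definitions using (Injective)

record Graph (n : ℕ) : Set where
  field
    adj   : Fin n → Fin n → Bool
    sym   : ∀ i j → adj i j ≡ adj j i
    loopless : ∀ i → adj i i ≡ false
open Graph public

∑ℕ : ∀ {n} → (Fin n → ℕ) → ℕ
∑ℕ {zero}  f = 0
∑ℕ {suc n} f = f zero +ℕ ∑ℕ (λ i → f (suc i))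

∑ : ∀ {n} → (Fin n → ℚ) → ℚ
∑ {zero}  f = 0ℚ
∑ {suc n} f = f zero + ∑ (λ i → f (suc i))

anyFin : ∀ {n} → (Fin n → Bool) → Bool
anyFin {zero}  f = false
anyFin {suc n} f = f zero ∨ anyFin (λ i → f (suc i))

count : ∀ {n} → (Fin n → Bool) → ℕ
count f = ∑ℕ (λ i → if f i then 1 else 0)

degree : ∀ {n} → Graph n → Fin n → ℕ
degree G i = count (adj G i)

isPendant : ∀ {n} → Graph n → Fin n → Bool
isPendant G i = degree G i ≡ᵇ 1

Pendant : ∀ {n} → Graph n → Fin n → Set
Pendant G i = degree G i ≡ 1

isQuasiPendant : ∀ {n} → Graph n → Fin n → Bool
isQuasiPendant G i = anyFin (λ j → adj G i j ∧ isPendant G j)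

QuasiPendant : ∀ {n} → Graph n → Fin n → Set
QuasiPendant G i = ∃ λ j → (adj G i j ≡ true) × Pendant G j

p : ∀ {n} → Graph n → ℕ
p G = count (isPendant G)

q : ∀ {n} → Graph n → ℕ
q G = count (isQuasiPendant G)

δ : ∀ {n} → Fin n → Fin n → Bool
δ i j = does (i ≟ j)

laplacian : ∀ {n} → Graph n → Fin n → Fin n → ℚ
laplacian G i j =
  if δ i j then (+ degree G i) / 1
  else (if adj G i j then - 1ℚ else 0ℚ)

Vector : ℕ → Set
Vector n = Fin n → ℚ

_·_ : ∀ {n} → (Fin n → Fin n → ℚ) → Vector n → Vector n
(M · v) i = ∑ (λ j → M i j * v j)

InEigenspace1 : ∀ {n} → Graph n → Vector n → Set
InEigenspace1 G v = ∀ i → (laplacian G · v) i ≡ v i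

LinIndep : ∀ {n k} → (Fin k → Vector n) → Set
LinIndep {n} {k} vs =
  (c : Fin k → ℚ) → (∀ i → ∑ (λ a → c a * vs a i) ≡ 0ℚ) → ∀ a → c a ≡ 0ℚ

-- m_{L(G)}(1) = m  :  the eigenspace of L(G) for eigenvalue 1 has dimension m
-- (L(G) is real symmetric, so geometric = algebraic multiplicity).
MultL1 : ∀ {n} → Graph n → ℕ → Set
MultL1 {n} G m =
  (Σ (Fin m → Vector n) λ vs → (∀ a → InEigenspace1 G (vs a)) × LinIndep vs)
  × ((ws : Fin (suc m) → Vector n) → (∀ a → InEigenspace1 G (ws a)) → ¬ LinIndep ws)

-- H (on Fin k) is the reduced graph of G (on Fin n) when
-- H is (isomorphic to) the induced subgraph G - S, where S is a set of pendant
-- vertices of G such that every quasi-pendant vertex of G is adjacent to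
-- exactly one pendant vertex of G outside S.  The embedding f identifies the
-- vertices of H with V(G) \ S.

InImage : ∀ {k n} → (Fin k → Fin n) → Fin n → Set
InImage f v = ∃ λ x → f x ≡ v

record IsReducedGraphOf {k n : ℕ} (H : Graph k) (G : Graph n) : Set where
  field
    emb        : Fin k → Fin n
    emb-inj    : Injective _≡_ _≡_ emb
    emb-adj    : ∀ x y → adj H x y ≡ adj G (emb x) (emb y)
    deleted-pendant : ∀ v → ¬ InImage emb v → Pendant G v
    one-left   : ∀ u → QuasiPendant G u →
                 Σ (Fin n) λ w → ((adj G u w ≡ true) × Pendant G w × InImage emb w)
                   × (∀ w' → adj G u w' ≡ true → Pendant G w' → InImage emb w' → w' ≡ w)

-- Let D be the set of pendant vertices deleted from G to obtain H, and d = |D|.  Every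
-- quasi-pendant vertex keeps exactly one pendant neighbour, so double counting the pairs
-- (quasi-pendant vertex, adjacent kept pendant vertex) gives p(G) - q(G) = d.
-- At a pendant vertex u with neighbour w the equation (L x)(u) = x(u) reads x(u) - x(w) = x(u), so
-- 1-eigenvectors vanish at neighbours of pendant vertices.  On vectors vanishing on D and at the
-- neighbours of D, L(G) restricted to V(H) is L(H).  Hence extension by zero embeds the
-- 1-eigenspace of H into that of G; adding the d eigenvectors e_u - e_u' (u in D, u' the kept
-- pendant vertex sharing the neighbour of u), which have pivots on D, gives m_G(1) >= m_H(1) + d.
-- Conversely, 1-eigenvectors of G vanishing on D restrict injectively to 1-eigenvectors of H, and
-- each of the d hyperplanes x(u) = 0 lowers the dimension by at most one: m_G(1) <= d + m_H(1).

module Submission where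

open import Defs
open import Data.Nat using (ℕ; _≤_; _+_; _∸_)
open import Relation.Binary.PropositionalEquality using (_≡_)

open import Algebra.Bundles using (CommutativeMonoid; CommutativeRing)
import Algebra.Properties.CommutativeMonoid.Sum as MonoidSum
import Algebra.Properties.Ring as RingProperties
import Algebra.Properties.Semiring.Sum as SemiringSum
open import Data.Bool using (Bool; true; false; if_then_else_; _∧_; _∨_)
import Data.Bool.Properties as BoolP
open import Data.Empty using (⊥-elim)
open import Data.Fin using (Fin; zero; suc; punchIn; splitAt; join; _↑ˡ_; _↑ʳ_)
open import Data.Fin.Permutation using (Permutation; permutation)
import Data.Fin.Properties as FinP
import Data.Integer as ℤ
open import Data.List as List using (List; _∷_; filter; allFin)
open import Data.List.Membership.Propositional using (_∈_)
open import Data.List.Membership.Propositional.Properties using (∈-lookup; ∈-filter⁻; ∈-filter⁺; ∈-allFin)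
import Data.List.Relation.Unary.All as All
import Data.List.Relation.Unary.Any as Any
open import Data.List.Relation.Unary.Any.Properties using (lookup-index)
open import Data.List.Relation.Unary.Unique.Propositional using (Unique; _∷_)
import Data.List.Relation.Unary.Unique.Propositional.Properties as UniqueP
open import Data.Nat using (zero; suc)
import Data.Nat.Properties as ℕP
open import Data.Product using (Σ; ∃; _×_; _,_; proj₁; proj₂)
import Data.Rational as ℚ
open import Data.Rational using (ℚ; 0ℚ; 1ℚ; -_; _-_; 1/_) renaming (_+_ to _+ℚ_; _*_ to _*ℚ_)
import Data.Rational.Properties as ℚP
open import Data.Rational.Solver using (module +-*-Solver)
import Data.Sum
open import Data.Sum using (_⊎_; inj₁; inj₂; [_,_])
open import Data.Vec.Functional using (_++_; insertAt; removeAt; replicate)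
open import Data.Vec.Functional.Properties using (lookup-++ˡ; lookup-++ʳ; insertAt-lookup; insertAt-punchIn)
open import Data.Vec.Functional.Relation.Unary.All.Properties using (++⁺)
open import Function using (_∘_; id)
open import Function.Bundles using (Equivalence)
open import Function.Definitions using (Injective)
open import Relation.Binary.PropositionalEquality as ≡
  using (refl; trans; cong; cong₂; _≢_; module ≡-Reasoning)
open import Relation.Nullary using (¬_; ¬?; Dec; yes; no; contradiction)
open import Relation.Nullary.Decidable using (dec-true; dec-false)

open +-*-Solver using (solve; _:+_; _:*_; _:-_; :-_; con; _:=_)

-- Finite sums

module _ {c ℓ} (M : CommutativeMonoid c ℓ) where
  open CommutativeMonoid M
    using (Carrier; _≈_; setoid; ∙-congˡ; identityˡ; identityʳ; assoc)
    renaming (_∙_ to _⊕_; ε to 0#; sym to ≈-sym; trans to ≈-trans)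
  open MonoidSum M using (sum; sum-remove; sum-cong-≋; sum-cong-≗; sum-replicate-zero; ∑-permute)
  open import Relation.Binary.Reasoning.Setoid setoid

  sum-single : ∀ {n} (f : Fin n → Carrier) a → (∀ j → j ≢ a → f j ≈ 0#) → sum f ≈ f a
  sum-single {suc n} f a vanish = begin
    sum f                      ≈⟨ sum-remove {i = a} f ⟩
    f a ⊕ sum (removeAt f a)   ≈⟨ ∙-congˡ (sum-cong-≋ (λ i → vanish _ (FinP.punchInᵢ≢i a i))) ⟩
    f a ⊕ sum (replicate n 0#) ≈⟨ ∙-congˡ (sum-replicate-zero n) ⟩
    f a ⊕ 0#                   ≈⟨ identityʳ (f a) ⟩
    f a                        ∎

  sum-↑ : ∀ m {n} (f : Fin (m + n) → Carrier) → sum f ≈ sum (f ∘ (_↑ˡ n)) ⊕ sum (f ∘ (m ↑ʳ_))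
  sum-↑ zero    f = ≈-sym (identityˡ (sum f))
  sum-↑ (suc m) f = ≈-trans (∙-congˡ (sum-↑ m (f ∘ suc))) (≈-sym (assoc _ _ _))

  sum-partition : ∀ {k d n} (e₁ : Fin k → Fin n) (e₂ : Fin d → Fin n) →
    Injective _≡_ _≡_ e₁ → Injective _≡_ _≡_ e₂ → (∀ x y → e₁ x ≢ e₂ y) →
    (∀ v → InImage e₁ v ⊎ InImage e₂ v) →
    (f : Fin n → Carrier) → sum f ≈ sum (f ∘ e₁) ⊕ sum (f ∘ e₂)
  sum-partition {k} {d} {n} e₁ e₂ e₁-inj e₂-inj disjoint cover f = begin
    sum f                                        ≈⟨ ∑-permute f π ⟩
    sum (f ∘ (e₁ ++ e₂))                         ≈⟨ sum-↑ k (f ∘ (e₁ ++ e₂)) ⟩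
    sum (f ∘ (e₁ ++ e₂) ∘ (_↑ˡ d)) ⊕ sum (f ∘ (e₁ ++ e₂) ∘ (k ↑ʳ_))
      ≡⟨ cong₂ _⊕_ (sum-cong-≗ (cong f ∘ lookup-++ˡ e₁ e₂))
                   (sum-cong-≗ (cong f ∘ lookup-++ʳ e₁ e₂)) ⟩
    sum (f ∘ e₁) ⊕ sum (f ∘ e₂)                  ∎
    where
    locate : Fin n → Fin k ⊎ Fin d
    locate v = Data.Sum.map proj₁ proj₁ (cover v)

    [e₁,e₂]∘locate : ∀ v → [ e₁ , e₂ ] (locate v) ≡ v
    [e₁,e₂]∘locate v with cover v
    ... | inj₁ (_ , eq) = eq
    ... | inj₂ (_ , eq) = eq

    locate∘[e₁,e₂] : ∀ s → locate ([ e₁ , e₂ ] s) ≡ s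
    locate∘[e₁,e₂] (inj₁ x) with cover (e₁ x)
    ... | inj₁ (_ , eq) = cong inj₁ (e₁-inj eq)
    ... | inj₂ (y , eq) = ⊥-elim (disjoint x y (≡.sym eq))
    locate∘[e₁,e₂] (inj₂ y) with cover (e₂ y)
    ... | inj₁ (x , eq) = ⊥-elim (disjoint x y eq)
    ... | inj₂ (_ , eq) = cong inj₂ (e₂-inj eq)

    π : Permutation (k + d) n
    π = permutation (e₁ ++ e₂) (join k d ∘ locate)
      (λ v → trans (cong [ e₁ , e₂ ] (FinP.splitAt-join k d (locate v))) ([e₁,e₂]∘locate v))
      (λ i → trans (cong (join k d) (locate∘[e₁,e₂] (splitAt k i))) (FinP.join-splitAt k d i))

module ℚΣ = SemiringSum (CommutativeRing.semiring ℚP.+-*-commutativeRing)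
module ℚR = RingProperties (CommutativeRing.ring ℚP.+-*-commutativeRing)
module ℕΣ = MonoidSum ℕP.+-0-commutativeMonoid

∑≡sum : ∀ {n} (f : Fin n → ℚ) → ∑ f ≡ ℚΣ.sum f
∑≡sum {zero}  f = refl
∑≡sum {suc n} f = cong (f zero +ℚ_) (∑≡sum (f ∘ suc))

∑ℕ≡sum : ∀ {n} (f : Fin n → ℕ) → ∑ℕ f ≡ ℕΣ.sum f
∑ℕ≡sum {zero}  f = refl
∑ℕ≡sum {suc n} f = cong (f zero +_) (∑ℕ≡sum (f ∘ suc))

∑-cong : ∀ {n} {f g : Fin n → ℚ} → (∀ i → f i ≡ g i) → ∑ f ≡ ∑ g
∑-cong {f = f} {g} f≗g = trans (∑≡sum f) (trans (ℚΣ.sum-cong-≗ f≗g) (≡.sym (∑≡sum g)))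

∑-zero : ∀ {n} {f : Fin n → ℚ} → (∀ i → f i ≡ 0ℚ) → ∑ f ≡ 0ℚ
∑-zero {n} {f} f≗0 = trans (∑≡sum f) (trans (ℚΣ.sum-cong-≗ f≗0) (ℚΣ.sum-replicate-zero n))

∑-single : ∀ {n} (f : Fin n → ℚ) a → (∀ j → j ≢ a → f j ≡ 0ℚ) → ∑ f ≡ f a
∑-single f a vanish = trans (∑≡sum f) (sum-single ℚP.+-0-commutativeMonoid f a vanish)

∑-remove : ∀ {n} (f : Fin (suc n) → ℚ) a → ∑ f ≡ f a +ℚ ∑ (f ∘ punchIn a)
∑-remove f a = trans (∑≡sum f)
  (trans (ℚΣ.sum-remove {i = a} f) (cong (f a +ℚ_) (≡.sym (∑≡sum (f ∘ punchIn a)))))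

∑-↑ : ∀ m {n} (f : Fin (m + n) → ℚ) → ∑ f ≡ ∑ (f ∘ (_↑ˡ n)) +ℚ ∑ (f ∘ (m ↑ʳ_))
∑-↑ m {n} f = trans (∑≡sum f)
  (trans (sum-↑ ℚP.+-0-commutativeMonoid m f)
         (≡.sym (cong₂ _+ℚ_ (∑≡sum (f ∘ (_↑ˡ n))) (∑≡sum (f ∘ (m ↑ʳ_))))))

*-distribˡ-∑ : ∀ {n} c (f : Fin n → ℚ) → c *ℚ ∑ f ≡ ∑ (λ i → c *ℚ f i)
*-distribˡ-∑ c f =
  trans (cong (c *ℚ_) (∑≡sum f)) (trans (ℚΣ.*-distribˡ-sum c f) (≡.sym (∑≡sum (λ i → c *ℚ f i))))

*-distribʳ-∑ : ∀ {n} c (f : Fin n → ℚ) → ∑ f *ℚ c ≡ ∑ (λ i → f i *ℚ c)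
*-distribʳ-∑ c f =
  trans (cong (_*ℚ c) (∑≡sum f)) (trans (ℚΣ.*-distribʳ-sum c f) (≡.sym (∑≡sum (λ i → f i *ℚ c))))

∑-sub : ∀ {n} (f g : Fin n → ℚ) → ∑ (λ i → f i - g i) ≡ ∑ f - ∑ g
∑-sub f g = begin
  ∑ (λ i → f i - g i)          ≡⟨ trans (∑≡sum (λ i → f i - g i)) (ℚΣ.∑-distrib-+ f (-_ ∘ g)) ⟩
  ℚΣ.sum f +ℚ ℚΣ.sum (-_ ∘ g)  ≡⟨ ≡.sym (cong₂ _+ℚ_ (∑≡sum f) (∑≡sum (-_ ∘ g))) ⟩
  ∑ f +ℚ ∑ (-_ ∘ g)            ≡⟨ cong (∑ f +ℚ_) ∑-neg ⟩
  ∑ f - ∑ g                    ∎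
  where
  open ≡-Reasoning
  ∑-neg : ∑ (-_ ∘ g) ≡ - ∑ g
  ∑-neg = begin
    ∑ (-_ ∘ g)                    ≡⟨ ∑-cong (λ i → ≡.sym (ℚR.-1*x≈-x (g i))) ⟩
    ∑ (λ i → - 1ℚ *ℚ g i)         ≡⟨ ≡.sym (*-distribˡ-∑ (- 1ℚ) g) ⟩
    - 1ℚ *ℚ ∑ g                   ≡⟨ ℚR.-1*x≈-x (∑ g) ⟩
    - ∑ g                         ∎

∑-partition : ∀ {k d n} (e₁ : Fin k → Fin n) (e₂ : Fin d → Fin n) →
  Injective _≡_ _≡_ e₁ → Injective _≡_ _≡_ e₂ → (∀ x y → e₁ x ≢ e₂ y) →
  (∀ v → InImage e₁ v ⊎ InImage e₂ v) →
  (f : Fin n → ℚ) → ∑ f ≡ ∑ (f ∘ e₁) +ℚ ∑ (f ∘ e₂)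
∑-partition e₁ e₂ e₁-inj e₂-inj disjoint cover f = trans (∑≡sum f)
  (trans (sum-partition ℚP.+-0-commutativeMonoid e₁ e₂ e₁-inj e₂-inj disjoint cover f)
         (≡.sym (cong₂ _+ℚ_ (∑≡sum (f ∘ e₁)) (∑≡sum (f ∘ e₂)))))

∑ℕ-cong : ∀ {n} {f g : Fin n → ℕ} → (∀ i → f i ≡ g i) → ∑ℕ f ≡ ∑ℕ g
∑ℕ-cong {f = f} {g} f≗g = trans (∑ℕ≡sum f) (trans (ℕΣ.sum-cong-≗ f≗g) (≡.sym (∑ℕ≡sum g)))

∑ℕ-single : ∀ {n} (f : Fin n → ℕ) a → (∀ j → j ≢ a → f j ≡ 0) → ∑ℕ f ≡ f a
∑ℕ-single f a vanish = trans (∑ℕ≡sum f) (sum-single ℕP.+-0-commutativeMonoid f a vanish)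

∑ℕ-comm : ∀ {m n} (f : Fin m → Fin n → ℕ) →
  ∑ℕ (λ i → ∑ℕ (f i)) ≡ ∑ℕ (λ j → ∑ℕ (λ i → f i j))
∑ℕ-comm f = begin
  ∑ℕ (λ i → ∑ℕ (f i))
    ≡⟨ trans (∑ℕ-cong (∑ℕ≡sum ∘ f)) (∑ℕ≡sum (λ i → ℕΣ.sum (f i))) ⟩
  ℕΣ.sum (λ i → ℕΣ.sum (f i))
    ≡⟨ ℕΣ.∑-comm f ⟩
  ℕΣ.sum (λ j → ℕΣ.sum (λ i → f i j))
    ≡⟨ ≡.sym (trans (∑ℕ-cong (λ j → ∑ℕ≡sum (λ i → f i j))) (∑ℕ≡sum (λ j → ℕΣ.sum (λ i → f i j)))) ⟩
  ∑ℕ (λ j → ∑ℕ (λ i → f i j)) ∎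
  where open ≡-Reasoning

∑ℕ-partition : ∀ {k d n} (e₁ : Fin k → Fin n) (e₂ : Fin d → Fin n) →
  Injective _≡_ _≡_ e₁ → Injective _≡_ _≡_ e₂ → (∀ x y → e₁ x ≢ e₂ y) →
  (∀ v → InImage e₁ v ⊎ InImage e₂ v) →
  (f : Fin n → ℕ) → ∑ℕ f ≡ ∑ℕ (f ∘ e₁) + ∑ℕ (f ∘ e₂)
∑ℕ-partition e₁ e₂ e₁-inj e₂-inj disjoint cover f = trans (∑ℕ≡sum f)
  (trans (sum-partition ℕP.+-0-commutativeMonoid e₁ e₂ e₁-inj e₂-inj disjoint cover f)
         (≡.sym (cong₂ _+_ (∑ℕ≡sum (f ∘ e₁)) (∑ℕ≡sum (f ∘ e₂)))))

-- Linear independence and dimension bounds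

basis : ∀ {n} → Fin n → Vector n
basis u v = if δ u v then 1ℚ else 0ℚ

basis-diag : ∀ {n} (u : Fin n) → basis u u ≡ 1ℚ
basis-diag u = cong (if_then 1ℚ else 0ℚ) (dec-true (u FinP.≟ u) refl)

basis-off : ∀ {n} {u v : Fin n} → u ≢ v → basis u v ≡ 0ℚ
basis-off {u = u} {v} u≢v = cong (if_then 1ℚ else 0ℚ) (dec-false (u FinP.≟ v) u≢v)

∑-basis : ∀ {n} (f : Fin n → ℚ) u → ∑ (λ v → f v *ℚ basis u v) ≡ f u
∑-basis f u = trans (∑-single _ u off) (trans (cong (f u *ℚ_) (basis-diag u)) (ℚP.*-identityʳ (f u)))
  where
  off : ∀ v → v ≢ u → f v *ℚ basis u v ≡ 0ℚ
  off v v≢u = trans (cong (f v *ℚ_) (basis-off (v≢u ∘ ≡.sym))) (ℚP.*-zeroʳ (f v))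

-- MultL1 G m unfolds to an independent family of m eigenvectors together with
-- DimAtMost (InEigenspace1 G) m.
DimAtMost : ∀ {N} → (Vector N → Set) → ℕ → Set
DimAtMost {N} P r = (ws : Fin (suc r) → Vector N) → (∀ a → P (ws a)) → ¬ LinIndep ws

ClosedUnderElimination : ∀ {N} → (Vector N → Set) → Set
ClosedUnderElimination P = ∀ x y t → P x → P y → P (λ i → x i - t *ℚ y i)

LinIndep-tail : ∀ {N s} {ws : Fin (suc s) → Vector N} → LinIndep ws → LinIndep (ws ∘ suc)
LinIndep-tail {ws = ws} ind c comb≡0 a =
  ind (insertAt c zero 0ℚ) (λ i → trans (drop-zero-term i) (comb≡0 i)) (suc a)
  where
  drop-zero-term : ∀ i → 0ℚ *ℚ ws zero i +ℚ ∑ (λ b → c b *ℚ ws (suc b) i) ≡ ∑ (λ b → c b *ℚ ws (suc b) i)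
  drop-zero-term i = trans (cong (_+ℚ rest) (ℚP.*-zeroˡ (ws zero i))) (ℚP.+-identityˡ rest)
    where
    rest : ℚ
    rest = ∑ (λ b → c b *ℚ ws (suc b) i)

LinIndep-eliminate : ∀ {N s} {ws : Fin (suc s) → Vector N} → LinIndep ws →
  ∀ a (μ : Fin s → ℚ) → LinIndep (λ b i → ws (punchIn a b) i - μ b *ℚ ws a i)
LinIndep-eliminate {ws = ws} ind a μ c comb≡0 b =
  trans (≡.sym (insertAt-punchIn c a (- K) b)) (ind C C-comb≡0 (punchIn a b))
  where
  K : ℚ
  K = ∑ (λ b → c b *ℚ μ b)
  C : Fin _ → ℚ
  C = insertAt c a (- K)
  C-comb≡0 : ∀ i → ∑ (λ k → C k *ℚ ws k i) ≡ 0ℚ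
  C-comb≡0 i = begin
    ∑ (λ k → C k *ℚ ws k i)
      ≡⟨ ∑-remove (λ k → C k *ℚ ws k i) a ⟩
    C a *ℚ A +ℚ ∑ (λ b → C (punchIn a b) *ℚ W b)
      ≡⟨ cong₂ _+ℚ_ (cong (_*ℚ A) (insertAt-lookup c a (- K)))
                     (∑-cong (λ b → cong (_*ℚ W b) (insertAt-punchIn c a (- K) b))) ⟩
    - K *ℚ A +ℚ ∑ (λ b → c b *ℚ W b)
      ≡⟨ solve 3 (λ k a s → (:- k) :* a :+ s := s :- k :* a) refl K A (∑ (λ b → c b *ℚ W b)) ⟩
    ∑ (λ b → c b *ℚ W b) - K *ℚ A
      ≡⟨ cong (λ x → ∑ (λ b → c b *ℚ W b) - x) (*-distribʳ-∑ A (λ b → c b *ℚ μ b)) ⟩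
    ∑ (λ b → c b *ℚ W b) - ∑ (λ b → c b *ℚ μ b *ℚ A)
      ≡⟨ ≡.sym (∑-sub (λ b → c b *ℚ W b) (λ b → c b *ℚ μ b *ℚ A)) ⟩
    ∑ (λ b → c b *ℚ W b - c b *ℚ μ b *ℚ A)
      ≡⟨ ∑-cong (λ b →
           solve 4 (λ c w m a → c :* w :- c :* m :* a := c :* (w :- m :* a)) refl (c b) (W b) (μ b) A) ⟩
    ∑ (λ b → c b *ℚ (W b - μ b *ℚ A))
      ≡⟨ comb≡0 i ⟩
    0ℚ ∎
    where
    open ≡-Reasoning
    A : ℚ
    A = ws a i
    W : Fin _ → ℚ
    W b = ws (punchIn a b) i

module _ {N : ℕ} {P : Vector N → Set} where

  DimAtMost-suc : ∀ {r} → DimAtMost P r → DimAtMost P (suc r)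
  DimAtMost-suc bound ws ws∈P = bound (ws ∘ suc) (ws∈P ∘ suc) ∘ LinIndep-tail {ws = ws}

  DimAtMost-+ : ∀ t {r} → DimAtMost P r → DimAtMost P (t + r)
  DimAtMost-+ zero    = id
  DimAtMost-+ (suc t) = DimAtMost-suc ∘ DimAtMost-+ t

  DimAtMost-mono : ∀ {Q : Vector N → Set} {r} → (∀ {x} → Q x → P x) → DimAtMost P r → DimAtMost Q r
  DimAtMost-mono Q⇒P bound ws ws∈Q = bound ws (Q⇒P ∘ ws∈Q)

  independent⇒≤ : ∀ {r s} → DimAtMost P r →
    (vs : Fin s → Vector N) → (∀ a → P (vs a)) → LinIndep vs → s ≤ r
  independent⇒≤ {r} {s} bound vs vs∈P ind with s ℕP.≤? r
  ... | yes s≤r = s≤r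
  ... | no  s≰r = ⊥-elim (tooMany (s ∸ suc r) s≡ vs vs∈P ind)
    where
    s≡ : suc (s ∸ suc r + r) ≡ s
    s≡ = trans (≡.sym (ℕP.+-suc (s ∸ suc r) r)) (ℕP.m∸n+n≡m (ℕP.≰⇒> s≰r))
    tooMany : ∀ t {s′} → suc (t + r) ≡ s′ →
      (vs : Fin s′ → Vector N) → (∀ a → P (vs a)) → ¬ LinIndep vs
    tooMany t refl = DimAtMost-+ t bound

  DimAtMost-hyperplane : ∀ {r} → ClosedUnderElimination P → ∀ t →
    DimAtMost (λ x → P x × x t ≡ 0ℚ) r → DimAtMost P (suc r)
  DimAtMost-hyperplane closed t bound ws ws∈P ind with FinP.all? (λ a → ws a t ℚP.≟ 0ℚ)
  ... | yes ws[t]≡0 =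
    bound (ws ∘ suc) (λ a → ws∈P (suc a) , ws[t]≡0 (suc a)) (LinIndep-tail {ws = ws} ind)
  ... | no  ¬ws[t]≡0 with FinP.¬∀⟶∃¬ _ _ (λ a → ws a t ℚP.≟ 0ℚ) ¬ws[t]≡0
  ...   | a , pivot≢0 =
    bound u (λ b → closed _ _ (μ b) (ws∈P (punchIn a b)) (ws∈P a) , u[t]≡0 b) (LinIndep-eliminate {ws = ws} ind a μ)
    where
    instance
      pivot-nonZero : ℚ.NonZero (ws a t)
      pivot-nonZero = ℚ.≢-nonZero pivot≢0
    μ : Fin _ → ℚ
    μ b = ws (punchIn a b) t *ℚ 1/ (ws a t)
    u : Fin _ → Vector N
    u b i = ws (punchIn a b) i - μ b *ℚ ws a i
    u[t]≡0 : ∀ b → u b t ≡ 0ℚ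
    u[t]≡0 b = begin
      x - x *ℚ 1/ y *ℚ y   ≡⟨ cong (λ z → x - z) (ℚP.*-assoc x (1/ y) y) ⟩
      x - x *ℚ (1/ y *ℚ y) ≡⟨ cong (λ z → x - x *ℚ z) (ℚP.*-inverseˡ y) ⟩
      x - x *ℚ 1ℚ          ≡⟨ cong (λ z → x - z) (ℚP.*-identityʳ x) ⟩
      x - x                ≡⟨ ℚP.+-inverseʳ x ⟩
      0ℚ                   ∎
      where
      open ≡-Reasoning
      x y : ℚ
      x = ws (punchIn a b) t
      y = ws a t

DimAtMost-vanishing : ∀ {N r} {P : Vector N → Set} → ClosedUnderElimination P →
  ∀ {d} (e : Fin d → Fin N) → DimAtMost (λ x → P x × ∀ j → x (e j) ≡ 0ℚ) r → DimAtMost P (d + r)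
DimAtMost-vanishing {P = P} closed {zero} e bound =
  DimAtMost-mono {P = λ x → P x × ∀ j → x (e j) ≡ 0ℚ} {Q = P} (λ x∈P → x∈P , λ ()) bound
DimAtMost-vanishing {P = P} closed {suc d} e bound =
  DimAtMost-hyperplane closed (e zero)
    (DimAtMost-vanishing closed₀ (e ∘ suc) (DimAtMost-mono {Q = Q} regroup bound))
  where
  Q : Vector _ → Set
  Q x = (P x × x (e zero) ≡ 0ℚ) × (∀ j → x (e (suc j)) ≡ 0ℚ)
  closed₀ : ClosedUnderElimination (λ x → P x × x (e zero) ≡ 0ℚ)
  closed₀ x y t (x∈P , x₀≡0) (y∈P , y₀≡0) = closed x y t x∈P y∈P ,
    trans (cong₂ (λ a b → a - t *ℚ b) x₀≡0 y₀≡0)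
          (solve 1 (λ t → con 0ℚ :- t :* con 0ℚ := con 0ℚ) refl t)
  regroup : ∀ {x} → Q x → P x × ∀ j → x (e j) ≡ 0ℚ
  regroup ((x∈P , x₀≡0) , rest) = x∈P , λ { zero → x₀≡0 ; (suc j) → rest j }

LinIndep-++ : ∀ {N a b} {us : Fin a → Vector N} {vs : Fin b → Vector N} (pivot : Fin b → Fin N) →
  LinIndep us → (∀ x j → us x (pivot j) ≡ 0ℚ) → (∀ j j′ → vs j′ (pivot j) ≡ basis j j′) →
  LinIndep (us ++ vs)
LinIndep-++ {a = a} {b} {us} {vs} pivot us-ind us[pivot]≡0 vs[pivot]≡basis c comb≡0 k =
  trans (cong c (≡.sym (FinP.join-splitAt a b k))) (c∘join≡0 (splitAt a k))
  where
  open ≡-Reasoning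
  cᵤ : Fin a → ℚ
  cᵤ x = c (x ↑ˡ b)
  cᵥ : Fin b → ℚ
  cᵥ j = c (a ↑ʳ j)
  combᵤ combᵥ : Vector _
  combᵤ i = ∑ (λ x → cᵤ x *ℚ us x i)
  combᵥ i = ∑ (λ j → cᵥ j *ℚ vs j i)
  split : ∀ i → ∑ (λ k → c k *ℚ (us ++ vs) k i) ≡ combᵤ i +ℚ combᵥ i
  split i = trans (∑-↑ a (λ k → c k *ℚ (us ++ vs) k i))
    (cong₂ _+ℚ_ (∑-cong (λ x → cong (λ w → cᵤ x *ℚ w i) (lookup-++ˡ us vs x)))
                (∑-cong (λ j → cong (λ w → cᵥ j *ℚ w i) (lookup-++ʳ us vs j))))
  cᵥ≡0 : ∀ j → cᵥ j ≡ 0ℚ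
  cᵥ≡0 j = begin
    cᵥ j                                   ≡⟨ ≡.sym (∑-basis cᵥ j) ⟩
    ∑ (λ j′ → cᵥ j′ *ℚ basis j j′)         ≡⟨ ∑-cong (λ j′ → cong (cᵥ j′ *ℚ_) (vs[pivot]≡basis j j′)) ⟨
    combᵥ (pivot j)                        ≡⟨ ≡.sym (ℚP.+-identityˡ (combᵥ (pivot j))) ⟩
    0ℚ +ℚ combᵥ (pivot j)                  ≡⟨ cong (_+ℚ combᵥ (pivot j)) (≡.sym combᵤ[pivot]≡0) ⟩
    combᵤ (pivot j) +ℚ combᵥ (pivot j)     ≡⟨ ≡.sym (split (pivot j)) ⟩
    ∑ (λ k → c k *ℚ (us ++ vs) k (pivot j)) ≡⟨ comb≡0 (pivot j) ⟩
    0ℚ                                     ∎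
    where
    combᵤ[pivot]≡0 : combᵤ (pivot j) ≡ 0ℚ
    combᵤ[pivot]≡0 = ∑-zero (λ x → trans (cong (cᵤ x *ℚ_) (us[pivot]≡0 x j)) (ℚP.*-zeroʳ (cᵤ x)))
  cᵤ≡0 : ∀ x → cᵤ x ≡ 0ℚ
  cᵤ≡0 = us-ind cᵤ λ i → begin
    combᵤ i                     ≡⟨ ≡.sym (ℚP.+-identityʳ (combᵤ i)) ⟩
    combᵤ i +ℚ 0ℚ               ≡⟨ cong (combᵤ i +ℚ_) (≡.sym (combᵥ≡0 i)) ⟩
    combᵤ i +ℚ combᵥ i          ≡⟨ ≡.sym (split i) ⟩
    ∑ (λ k → c k *ℚ (us ++ vs) k i) ≡⟨ comb≡0 i ⟩
    0ℚ                          ∎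
    where
    combᵥ≡0 : ∀ i → combᵥ i ≡ 0ℚ
    combᵥ≡0 i = ∑-zero (λ j → trans (cong (_*ℚ vs j i) (cᵥ≡0 j)) (ℚP.*-zeroˡ (vs j i)))
  c∘join≡0 : ∀ s → c (join a b s) ≡ 0ℚ
  c∘join≡0 (inj₁ x) = cᵤ≡0 x
  c∘join≡0 (inj₂ j) = cᵥ≡0 j

count≡0 : ∀ {n} (f : Fin n → Bool) → count f ≡ 0 → ∀ j → f j ≡ false
count≡0 {suc n} f c≡0 j with f zero in f₀
... | true  = contradiction c≡0 λ ()
count≡0 {suc n} f c≡0 zero    | false = f₀
count≡0 {suc n} f c≡0 (suc j) | false = count≡0 (f ∘ suc) c≡0 j

count≡1 : ∀ {n} (f : Fin n → Bool) → count f ≡ 1 →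
  ∃ λ w → f w ≡ true × ∀ w′ → f w′ ≡ true → w′ ≡ w
count≡1 {suc n} f c≡1 with f zero in f₀
... | true  = zero , f₀ , onlyZero
  where
  onlyZero : ∀ w′ → f w′ ≡ true → w′ ≡ zero
  onlyZero zero    _   = refl
  onlyZero (suc j) f[j] =
    contradiction (trans (≡.sym f[j]) (count≡0 (f ∘ suc) (ℕP.suc-injective c≡1) j)) λ ()
... | false with count≡1 (f ∘ suc) c≡1
...   | w , f[w] , unique = suc w , f[w] , λ where
          zero    f₀′  → contradiction (trans (≡.sym f₀) f₀′) λ ()
          (suc j) f[j] → cong suc (unique j f[j])

count-false : ∀ {n} (f : Fin n → Bool) → (∀ j → f j ≡ false) → count f ≡ 0
count-false {n} f f≗false = trans (∑ℕ-cong (λ j → cong (if_then 1 else 0) (f≗false j)))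
                                  (trans (∑ℕ≡sum {n} (λ _ → 0)) (ℕΣ.sum-replicate-zero n))

count-true : ∀ {n} (f : Fin n → Bool) → (∀ j → f j ≡ true) → count f ≡ n
count-true {zero}  f f≗true = refl
count-true {suc n} f f≗true rewrite f≗true zero = cong suc (count-true (f ∘ suc) (f≗true ∘ suc))

count-unique : ∀ {n} (f : Fin n → Bool) a → f a ≡ true → (∀ j → f j ≡ true → j ≡ a) → count f ≡ 1
count-unique f a f[a] unique = trans (∑ℕ-single _ a off) (cong (if_then 1 else 0) f[a])
  where
  off : ∀ j → j ≢ a → (if f j then 1 else 0) ≡ 0
  off j j≢a with f j in f[j]
  ... | true  = contradiction (unique j f[j]) j≢a
  ... | false = refl

anyFin-sound : ∀ {n} (f : Fin n → Bool) → anyFin f ≡ true → ∃ λ j → f j ≡ true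
anyFin-sound {suc n} f any≡true with f zero in f₀
... | true  = zero , f₀
... | false = let j , f[j] = anyFin-sound (f ∘ suc) any≡true in suc j , f[j]

anyFin-complete : ∀ {n} (f : Fin n → Bool) j → f j ≡ true → anyFin f ≡ true
anyFin-complete f zero    f₀   rewrite f₀ = refl
anyFin-complete f (suc j) f[j] =
  trans (cong (f zero ∨_) (anyFin-complete (f ∘ suc) j f[j])) (BoolP.∨-zeroʳ (f zero))

-- The Laplacian

module _ {n} (M : Fin n → Fin n → ℚ) where

  ·-cong : ∀ {x y : Vector n} → (∀ j → x j ≡ y j) → ∀ i → (M · x) i ≡ (M · y) i
  ·-cong x≗y i = ∑-cong (λ j → cong (M i j *ℚ_) (x≗y j))

  ·-sub : ∀ (x y : Vector n) i → (M · (λ j → x j - y j)) i ≡ (M · x) i - (M · y) i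
  ·-sub x y i = trans
    (∑-cong (λ j → solve 3 (λ m a b → m :* (a :- b) := m :* a :- m :* b) refl (M i j) (x j) (y j)))
    (∑-sub (λ j → M i j *ℚ x j) (λ j → M i j *ℚ y j))

  ·-*ˡ : ∀ t (x : Vector n) i → (M · (λ j → t *ℚ x j)) i ≡ t *ℚ (M · x) i
  ·-*ˡ t x i = trans
    (∑-cong (λ j → solve 3 (λ m t a → m :* (t :* a) := t :* (m :* a)) refl (M i j) t (x j)))
    (≡.sym (*-distribˡ-∑ t (λ j → M i j *ℚ x j)))

  ·-basis : ∀ u i → (M · basis u) i ≡ M i u
  ·-basis u i = ∑-basis (M i) u

module _ {n} (G : Graph n) where

  degreeℚ : Fin n → ℚ
  degreeℚ v = (ℤ.+ degree G v) ℚ./ 1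

  neighbourSum : Vector n → Vector n
  neighbourSum x v = ∑ (λ w → if adj G v w then x w else 0ℚ)

  degreeℚ-pendant : ∀ {u} → Pendant G u → degreeℚ u ≡ 1ℚ
  degreeℚ-pendant pend = cong (λ k → (ℤ.+ k) ℚ./ 1) pend

  laplacian-diag : ∀ v → laplacian G v v ≡ degreeℚ v
  laplacian-diag v = cong (if_then degreeℚ v else _) (dec-true (v FinP.≟ v) refl)

  laplacian-off : ∀ {v w} → v ≢ w → laplacian G v w ≡ (if adj G v w then - 1ℚ else 0ℚ)
  laplacian-off {v} {w} v≢w = cong (if_then degreeℚ v else _) (dec-false (v FinP.≟ w) v≢w)

  laplacian-· : ∀ x v → (laplacian G · x) v ≡ degreeℚ v *ℚ x v - neighbourSum x v
  laplacian-· x v = begin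
    ∑ (λ w → laplacian G v w *ℚ x w)
      ≡⟨ ∑-cong entry ⟩
    ∑ (λ w → degreeℚ v *ℚ x w *ℚ basis v w - (if adj G v w then x w else 0ℚ))
      ≡⟨ ∑-sub (λ w → degreeℚ v *ℚ x w *ℚ basis v w) (λ w → if adj G v w then x w else 0ℚ) ⟩
    ∑ (λ w → degreeℚ v *ℚ x w *ℚ basis v w) - neighbourSum x v
      ≡⟨ cong (_- neighbourSum x v) (∑-basis (λ w → degreeℚ v *ℚ x w) v) ⟩
    degreeℚ v *ℚ x v - neighbourSum x v ∎
    where
    open ≡-Reasoning
    entry : ∀ w → laplacian G v w *ℚ x w ≡
                  degreeℚ v *ℚ x w *ℚ basis v w - (if adj G v w then x w else 0ℚ)
    entry w with v FinP.≟ w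
    ... | yes refl rewrite loopless G v =
      solve 2 (λ d y → d :* y := d :* y :* con 1ℚ :- con 0ℚ) refl (degreeℚ v) (x v)
    ... | no  _ with adj G v w
    ...   | true  = solve 2 (λ d y → (:- con 1ℚ) :* y := d :* y :* con 0ℚ :- y) refl (degreeℚ v) (x w)
    ...   | false = solve 2 (λ d y → con 0ℚ :* y := d :* y :* con 0ℚ :- con 0ℚ) refl (degreeℚ v) (x w)

  pendant-neighbour : ∀ {u} → Pendant G u → ∃ λ w → adj G u w ≡ true
  pendant-neighbour {u} pend = let w , uw , _ = count≡1 (adj G u) pend in w , uw

  pendant-unique : ∀ {u w w′} → Pendant G u → adj G u w ≡ true → adj G u w′ ≡ true → w′ ≡ w
  pendant-unique {u} pend uw uw′ =
    let _ , _ , unique = count≡1 (adj G u) pend in trans (unique _ uw′) (≡.sym (unique _ uw))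

  neighbourSum-pendant : ∀ x {u w} → Pendant G u → adj G u w ≡ true → neighbourSum x u ≡ x w
  neighbourSum-pendant x {u} {w} pend uw = trans (∑-single _ w off) (cong (if_then x w else 0ℚ) uw)
    where
    off : ∀ w′ → w′ ≢ w → (if adj G u w′ then x w′ else 0ℚ) ≡ 0ℚ
    off w′ w′≢w with adj G u w′ in uw′
    ... | true  = contradiction (pendant-unique pend uw uw′) w′≢w
    ... | false = refl

  laplacian-·-pendant : ∀ x {u w} → Pendant G u → adj G u w ≡ true → (laplacian G · x) u ≡ x u - x w
  laplacian-·-pendant x {u} {w} pend uw = begin
    (laplacian G · x) u                 ≡⟨ laplacian-· x u ⟩
    degreeℚ u *ℚ x u - neighbourSum x u
      ≡⟨ cong₂ (λ a b → a *ℚ x u - b) (degreeℚ-pendant pend) (neighbourSum-pendant x pend uw) ⟩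
    1ℚ *ℚ x u - x w                     ≡⟨ cong (_- x w) (ℚP.*-identityˡ (x u)) ⟩
    x u - x w                           ∎
    where open ≡-Reasoning

  eigenvector-vanishes-at-pendant-neighbour : ∀ {x u w} →
    InEigenspace1 G x → Pendant G u → adj G u w ≡ true → x w ≡ 0ℚ
  eigenvector-vanishes-at-pendant-neighbour {x} {u} {w} eigen pend uw = begin
    x w                 ≡⟨ solve 2 (λ a b → b := a :- (a :- b)) refl (x u) (x w) ⟩
    x u - (x u - x w)   ≡⟨ cong (λ y → x u - y) (trans (≡.sym (laplacian-·-pendant x pend uw)) (eigen u)) ⟩
    x u - x u           ≡⟨ ℚP.+-inverseʳ (x u) ⟩
    0ℚ                  ∎
    where open ≡-Reasoning

  InEigenspace1-closed : ClosedUnderElimination (InEigenspace1 G)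
  InEigenspace1-closed x y t x-eigen y-eigen i = begin
    (laplacian G · (λ j → x j - t *ℚ y j)) i
      ≡⟨ ·-sub (laplacian G) x (λ j → t *ℚ y j) i ⟩
    (laplacian G · x) i - (laplacian G · (λ j → t *ℚ y j)) i
      ≡⟨ cong (λ z → (laplacian G · x) i - z) (·-*ˡ (laplacian G) t y i) ⟩
    (laplacian G · x) i - t *ℚ (laplacian G · y) i
      ≡⟨ cong₂ (λ a b → a - t *ℚ b) (x-eigen i) (y-eigen i) ⟩
    x i - t *ℚ y i ∎
    where open ≡-Reasoning

  laplacian-pendant-column : ∀ {u w} → Pendant G u → adj G u w ≡ true →
    ∀ v → laplacian G v u ≡ basis u v - basis w v
  laplacian-pendant-column {u} {w} pend uw v = column (v FinP.≟ u) (v FinP.≟ w)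
    where
    open ≡-Reasoning
    column : Dec (v ≡ u) → Dec (v ≡ w) → laplacian G v u ≡ basis u v - basis w v
    column (yes refl) _ = begin
      laplacian G v v                  ≡⟨ laplacian-diag v ⟩
      degreeℚ v                        ≡⟨ degreeℚ-pendant pend ⟩
      1ℚ                               ≡⟨ cong₂ _-_ (basis-diag v) (basis-off w≢v) ⟨
      basis v v - basis w v            ∎
      where
      w≢v : w ≢ v
      w≢v refl = contradiction (trans (≡.sym uw) (loopless G v)) λ ()
    column (no v≢u) (yes refl) = begin
      laplacian G v u                  ≡⟨ laplacian-off v≢u ⟩
      (if adj G v u then - 1ℚ else 0ℚ) ≡⟨ cong (if_then - 1ℚ else 0ℚ) (trans (Graph.sym G v u) uw) ⟩
      - 1ℚ                             ≡⟨ cong₂ _-_ (basis-off (v≢u ∘ ≡.sym)) (basis-diag v) ⟨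
      basis u v - basis v v            ∎
    column (no v≢u) (no v≢w) = begin
      laplacian G v u                  ≡⟨ laplacian-off v≢u ⟩
      (if adj G v u then - 1ℚ else 0ℚ) ≡⟨ cong (if_then - 1ℚ else 0ℚ) vu≡false ⟩
      0ℚ                               ≡⟨ cong₂ _-_ (basis-off (v≢u ∘ ≡.sym)) (basis-off (v≢w ∘ ≡.sym)) ⟨
      basis u v - basis w v            ∎
      where
      vu≡false : adj G v u ≡ false
      vu≡false with adj G u v in uv
      ... | true  = contradiction (pendant-unique pend uw uv) v≢w
      ... | false = trans (Graph.sym G v u) uv

  twin-pendants-eigenvector : ∀ {a b w} →
    Pendant G a → Pendant G b → adj G a w ≡ true → adj G b w ≡ true → InEigenspace1 G (λ v → basis a v - basis b v)
  twin-pendants-eigenvector {a} {b} {w} pend-a pend-b aw bw v = begin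
    (laplacian G · (λ t → basis a t - basis b t)) v
      ≡⟨ ·-sub (laplacian G) (basis a) (basis b) v ⟩
    (laplacian G · basis a) v - (laplacian G · basis b) v
      ≡⟨ cong₂ _-_ (·-basis (laplacian G) a v) (·-basis (laplacian G) b v) ⟩
    laplacian G v a - laplacian G v b
      ≡⟨ cong₂ _-_ (laplacian-pendant-column pend-a aw v) (laplacian-pendant-column pend-b bw v) ⟩
    (basis a v - basis w v) - (basis b v - basis w v)
      ≡⟨ solve 3 (λ x y z → (x :- z) :- (y :- z) := x :- y) refl (basis a v) (basis b v) (basis w v) ⟩
    basis a v - basis b v ∎
    where open ≡-Reasoning

  isPendant-true : ∀ {u} → Pendant G u → isPendant G u ≡ true
  isPendant-true {u} = dec-true (degree G u ℕP.≟ 1)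

  isPendant-false : ∀ {u} → ¬ Pendant G u → isPendant G u ≡ false
  isPendant-false {u} = dec-false (degree G u ℕP.≟ 1)

  isPendant-sound : ∀ {u} → isPendant G u ≡ true → Pendant G u
  isPendant-sound {u} eq = ℕP.≡ᵇ⇒≡ (degree G u) 1 (Equivalence.from BoolP.T-≡ eq)

  isQuasiPendant-sound : ∀ {u} → isQuasiPendant G u ≡ true → QuasiPendant G u
  isQuasiPendant-sound {u} eq =
    let j , e = anyFin-sound _ eq
    in j , BoolP.∧-conicalˡ _ _ e , isPendant-sound (BoolP.∧-conicalʳ (adj G u j) _ e)

  isQuasiPendant-complete : ∀ {u} → QuasiPendant G u → isQuasiPendant G u ≡ true
  isQuasiPendant-complete {u} (j , uj , pend) = anyFin-complete _ j (cong₂ _∧_ uj (isPendant-true pend))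

-- Reduced graphs

lookup-injective : ∀ {A : Set} {xs : List A} → Unique xs → Injective _≡_ _≡_ (List.lookup xs)
lookup-injective (x∉xs ∷ unique) {zero}  {zero}  eq = refl
lookup-injective (x∉xs ∷ unique) {zero}  {suc j} eq = contradiction eq (All.lookup x∉xs (∈-lookup j))
lookup-injective (x∉xs ∷ unique) {suc i} {zero}  eq = contradiction (≡.sym eq) (All.lookup x∉xs (∈-lookup i))
lookup-injective (x∉xs ∷ unique) {suc i} {suc j} eq = cong suc (lookup-injective unique eq)

module Reduced {n k} {G : Graph n} {H : Graph k} (R : IsReducedGraphOf H G) where
  open IsReducedGraphOf R

  kept? : ∀ v → Dec (InImage emb v)
  kept? v = FinP.any? (λ i → emb i FinP.≟ v)

  deleted : List (Fin n)
  deleted = filter (¬? ∘ kept?) (allFin n)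

  d : ℕ
  d = List.length deleted

  del : Fin d → Fin n
  del = List.lookup deleted

  del-deleted : ∀ j → ¬ InImage emb (del j)
  del-deleted j = proj₂ (∈-filter⁻ (¬? ∘ kept?) {xs = allFin n} (∈-lookup j))

  del-injective : Injective _≡_ _≡_ del
  del-injective = lookup-injective (UniqueP.filter⁺ (¬? ∘ kept?) (UniqueP.allFin⁺ n))

  del-pendant : ∀ j → Pendant G (del j)
  del-pendant j = deleted-pendant (del j) (del-deleted j)

  emb≢del : ∀ i j → emb i ≢ del j
  emb≢del i j eq = del-deleted j (i , eq)

  kept-or-deleted : ∀ v → InImage emb v ⊎ InImage del v
  kept-or-deleted v with kept? v
  ... | yes kept = inj₁ kept
  ... | no  ¬kept = inj₂ (Any.index v∈ , ≡.sym (lookup-index v∈))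
    where
    v∈ : v ∈ deleted
    v∈ = ∈-filter⁺ (¬? ∘ kept?) (∈-allFin v) ¬kept

  ∑-split : (f : Fin n → ℚ) → ∑ f ≡ ∑ (f ∘ emb) +ℚ ∑ (f ∘ del)
  ∑-split = ∑-partition emb del emb-inj del-injective emb≢del kept-or-deleted

  ∑ℕ-split : (f : Fin n → ℕ) → ∑ℕ f ≡ ∑ℕ (f ∘ emb) + ∑ℕ (f ∘ del)
  ∑ℕ-split = ∑ℕ-partition emb del emb-inj del-injective emb≢del kept-or-deleted

  degree-split : ∀ i → degree G (emb i) ≡ degree H i + count (λ j → adj G (emb i) (del j))
  degree-split i = trans (∑ℕ-split (λ v → if adj G (emb i) v then 1 else 0))
    (cong (_+ count (λ j → adj G (emb i) (del j)))
          (∑ℕ-cong (λ i′ → cong (if_then 1 else 0) (≡.sym (emb-adj i i′)))))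

  neighbourSum-split : ∀ x i → neighbourSum G x (emb i) ≡
    neighbourSum H (x ∘ emb) i +ℚ ∑ (λ j → if adj G (emb i) (del j) then x (del j) else 0ℚ)
  neighbourSum-split x i = trans (∑-split (λ v → if adj G (emb i) v then x v else 0ℚ))
    (cong (_+ℚ ∑ (λ j → if adj G (emb i) (del j) then x (del j) else 0ℚ))
          (∑-cong (λ i′ → cong (if_then x (emb i′) else 0ℚ) (≡.sym (emb-adj i i′)))))

  -- A deleted w would be pendant, making u quasi-pendant with w as its only candidate kept pendant neighbour.
  pendant-neighbour-kept : ∀ {u w} → Pendant G u → adj G u w ≡ true → InImage emb w
  pendant-neighbour-kept {u} {w} pend uw with kept? w
  ... | yes kept = kept
  ... | no  ¬kept =
    let w′ , (uw′ , _ , w′-kept) , _ = one-left u (w , uw , deleted-pendant w ¬kept)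
    in ≡.subst (InImage emb) (pendant-unique G pend uw uw′) w′-kept

  degree-kept : ∀ {i} → (∀ j → adj G (emb i) (del j) ≡ false) → degree G (emb i) ≡ degree H i
  degree-kept {i} no-deleted-neighbour = begin
    degree G (emb i)
      ≡⟨ degree-split i ⟩
    degree H i + count (λ j → adj G (emb i) (del j))
      ≡⟨ cong (degree H i +_) (count-false _ no-deleted-neighbour) ⟩
    degree H i + 0
      ≡⟨ ℕP.+-identityʳ (degree H i) ⟩
    degree H i ∎
    where open ≡-Reasoning

  kept-pendant : ∀ {i} → Pendant G (emb i) → Pendant H i
  kept-pendant {i} pend = trans (≡.sym (degree-kept no-deleted-neighbour)) pend
    where
    no-deleted-neighbour : ∀ j → adj G (emb i) (del j) ≡ false
    no-deleted-neighbour j with adj G (emb i) (del j) in adjacent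
    ... | false = refl
    ... | true  = contradiction (pendant-neighbour-kept pend adjacent) (del-deleted j)

  H-eigenvector-vanishes-at-quasiPendant : ∀ {y i} → InEigenspace1 H y → QuasiPendant G (emb i) → y i ≡ 0ℚ
  H-eigenvector-vanishes-at-quasiPendant {y} {i} eigen qp with one-left (emb i) qp
  ... | _ , (iw , w-pendant , i′ , refl) , _ =
    eigenvector-vanishes-at-pendant-neighbour H eigen (kept-pendant w-pendant)
      (trans (emb-adj i′ i) (trans (Graph.sym G (emb i′) (emb i)) iw))

  -- Deleted neighbours of emb i add nothing to the neighbour sum, and where they change the degree
  -- the coordinate x (emb i) itself vanishes.
  laplacian-restrict : ∀ x → (∀ j → x (del j) ≡ 0ℚ) →
    (∀ i j → adj G (emb i) (del j) ≡ true → x (emb i) ≡ 0ℚ) → ∀ i → (laplacian G · x) (emb i) ≡ (laplacian H · (x ∘ emb)) i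
  laplacian-restrict x x∘del≡0 vanishes-near-deleted i = begin
    (laplacian G · x) (emb i)                                 ≡⟨ laplacian-· G x (emb i) ⟩
    degreeℚ G (emb i) *ℚ x (emb i) - neighbourSum G x (emb i) ≡⟨ cong₂ _-_ degree-term neighbour-term ⟩
    degreeℚ H i *ℚ x (emb i) - neighbourSum H (x ∘ emb) i     ≡⟨ ≡.sym (laplacian-· H (x ∘ emb) i) ⟩
    (laplacian H · (x ∘ emb)) i                               ∎
    where
    open ≡-Reasoning
    neighbour-term : neighbourSum G x (emb i) ≡ neighbourSum H (x ∘ emb) i
    neighbour-term = begin
      neighbourSum G x (emb i)
        ≡⟨ neighbourSum-split x i ⟩
      neighbourSum H (x ∘ emb) i +ℚ ∑ (λ j → if adj G (emb i) (del j) then x (del j) else 0ℚ)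
        ≡⟨ cong (neighbourSum H (x ∘ emb) i +ℚ_) (∑-zero (λ j →
             trans (cong (if adj G (emb i) (del j) then_else 0ℚ) (x∘del≡0 j)) (BoolP.if-eta _))) ⟩
      neighbourSum H (x ∘ emb) i +ℚ 0ℚ
        ≡⟨ ℚP.+-identityʳ (neighbourSum H (x ∘ emb) i) ⟩
      neighbourSum H (x ∘ emb) i ∎
    degree-term : degreeℚ G (emb i) *ℚ x (emb i) ≡ degreeℚ H i *ℚ x (emb i)
    degree-term with FinP.any? (λ j → adj G (emb i) (del j) BoolP.≟ true)
    ... | yes (j , adjacent) = begin
      degreeℚ G (emb i) *ℚ x (emb i) ≡⟨ cong (degreeℚ G (emb i) *ℚ_) x≡0 ⟩
      degreeℚ G (emb i) *ℚ 0ℚ        ≡⟨ ℚP.*-zeroʳ (degreeℚ G (emb i)) ⟩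
      0ℚ                             ≡⟨ ≡.sym (ℚP.*-zeroʳ (degreeℚ H i)) ⟩
      degreeℚ H i *ℚ 0ℚ              ≡⟨ cong (degreeℚ H i *ℚ_) (≡.sym x≡0) ⟩
      degreeℚ H i *ℚ x (emb i)       ∎
      where
      x≡0 : x (emb i) ≡ 0ℚ
      x≡0 = vanishes-near-deleted i j adjacent
    ... | no ¬adjacent = cong (λ k → (ℤ.+ k) ℚ./ 1 *ℚ x (emb i))
      (degree-kept (λ j → BoolP.¬-not (λ adjacent → ¬adjacent (j , adjacent))))

  extend : Vector k → Vector n
  extend y v with kept? v
  ... | yes (i , _) = y i
  ... | no  _       = 0ℚ

  extend-kept : ∀ y i → extend y (emb i) ≡ y i
  extend-kept y i with kept? (emb i)
  ... | yes (_ , eq) = cong y (emb-inj eq)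
  ... | no  ¬kept    = contradiction (i , refl) ¬kept

  extend-deleted : ∀ y j → extend y (del j) ≡ 0ℚ
  extend-deleted y j with kept? (del j)
  ... | yes kept = contradiction kept (del-deleted j)
  ... | no  _    = refl

  extend-eigenvector : ∀ {y} → InEigenspace1 H y → InEigenspace1 G (extend y)
  extend-eigenvector {y} eigen v with kept-or-deleted v
  ... | inj₁ (i , refl) = begin
    (laplacian G · extend y) (emb i)         ≡⟨ laplacian-restrict (extend y) (extend-deleted y) near-deleted i ⟩
    (laplacian H · (extend y ∘ emb)) i       ≡⟨ ·-cong (laplacian H) (extend-kept y) i ⟩
    (laplacian H · y) i                      ≡⟨ eigen i ⟩
    y i                                      ≡⟨ ≡.sym (extend-kept y i) ⟩
    extend y (emb i)                         ∎
    where
    open ≡-Reasoning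
    near-deleted : ∀ i j → adj G (emb i) (del j) ≡ true → extend y (emb i) ≡ 0ℚ
    near-deleted i j adjacent =
      trans (extend-kept y i) (H-eigenvector-vanishes-at-quasiPendant eigen (del j , adjacent , del-pendant j))
  ... | inj₂ (j , refl) with pendant-neighbour G (del-pendant j)
  ...   | w , jw with pendant-neighbour-kept (del-pendant j) jw
  ...     | i , refl = begin
    (laplacian G · extend y) (del j)         ≡⟨ laplacian-·-pendant G (extend y) (del-pendant j) jw ⟩
    extend y (del j) - extend y (emb i)      ≡⟨ cong₂ _-_ (extend-deleted y j) (trans (extend-kept y i) y≡0) ⟩
    0ℚ - 0ℚ                                  ≡⟨ ℚP.+-inverseʳ 0ℚ ⟩
    0ℚ                                       ≡⟨ ≡.sym (extend-deleted y j) ⟩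
    extend y (del j)                         ∎
    where
    open ≡-Reasoning
    y≡0 : y i ≡ 0ℚ
    y≡0 = H-eigenvector-vanishes-at-quasiPendant eigen
            (del j , trans (Graph.sym G (emb i) (del j)) jw , del-pendant j)

  restrict-eigenvector : ∀ {x} → InEigenspace1 G x → (∀ j → x (del j) ≡ 0ℚ) → InEigenspace1 H (x ∘ emb)
  restrict-eigenvector {x} eigen x∘del≡0 i =
    trans (≡.sym (laplacian-restrict x x∘del≡0 near-deleted i)) (eigen (emb i))
    where
    near-deleted : ∀ i j → adj G (emb i) (del j) ≡ true → x (emb i) ≡ 0ℚ
    near-deleted i j adjacent =
      eigenvector-vanishes-at-pendant-neighbour G eigen (del-pendant j) (trans (Graph.sym G (del j) (emb i)) adjacent)

  DimAtMost-vanishing-on-deleted : ∀ {r} → DimAtMost (InEigenspace1 H) r →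
    DimAtMost (λ x → InEigenspace1 G x × ∀ j → x (del j) ≡ 0ℚ) r
  DimAtMost-vanishing-on-deleted bound ws ws∈ ind =
    bound (λ a → ws a ∘ emb) (λ a → restrict-eigenvector (proj₁ (ws∈ a)) (proj₂ (ws∈ a)))
      restriction-independent
    where
    restriction-independent : LinIndep (λ a → ws a ∘ emb)
    restriction-independent c comb≡0 = ind c comb≡0′
      where
      comb≡0′ : ∀ v → ∑ (λ a → c a *ℚ ws a v) ≡ 0ℚ
      comb≡0′ v with kept-or-deleted v
      ... | inj₁ (i , refl) = comb≡0 i
      ... | inj₂ (j , refl) = ∑-zero (λ a → trans (cong (c a *ℚ_) (proj₂ (ws∈ a) j)) (ℚP.*-zeroʳ (c a)))

  multiplicity-≤ : ∀ {m m′} → MultL1 G m → MultL1 H m′ → m ≤ d + m′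
  multiplicity-≤ ((vs , vs-eigen , vs-ind) , _) (_ , bound) =
    independent⇒≤ {P = InEigenspace1 G}
      (DimAtMost-vanishing (InEigenspace1-closed G) del (DimAtMost-vanishing-on-deleted bound)) vs vs-eigen vs-ind

  hub : Fin d → Fin n
  hub j = proj₁ (pendant-neighbour G (del-pendant j))

  del-hub : ∀ j → adj G (del j) (hub j) ≡ true
  del-hub j = proj₂ (pendant-neighbour G (del-pendant j))

  keptTwin : ∀ j → Σ (Fin n) λ u → adj G (hub j) u ≡ true × Pendant G u × InImage emb u
  keptTwin j =
    let u , facts , _ = one-left (hub j) (del j , trans (Graph.sym G (hub j) (del j)) (del-hub j) , del-pendant j)
    in u , facts

  twin : Fin d → Fin n
  twin = proj₁ ∘ keptTwin

  twin≢del : ∀ j j′ → twin j ≢ del j′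
  twin≢del j j′ eq = del-deleted j′ (≡.subst (InImage emb) eq (proj₂ (proj₂ (proj₂ (keptTwin j)))))

  twinVector : Fin d → Vector n
  twinVector j v = basis (del j) v - basis (twin j) v

  twinVector-eigenvector : ∀ j → InEigenspace1 G (twinVector j)
  twinVector-eigenvector j =
    let u , hub-u , u-pendant , _ = keptTwin j
    in twin-pendants-eigenvector G (del-pendant j) u-pendant (del-hub j) (trans (Graph.sym G u (hub j)) hub-u)

  twinVector-pivot : ∀ j j′ → twinVector j′ (del j) ≡ basis j j′
  twinVector-pivot j j′ with j FinP.≟ j′
  ... | yes refl = cong₂ _-_ (basis-diag (del j)) (basis-off (twin≢del j j))
  ... | no  j≢j′ = cong₂ _-_ (basis-off (j≢j′ ∘ ≡.sym ∘ del-injective)) (basis-off (twin≢del j′ j))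

  multiplicity-≥ : ∀ {m m′} → MultL1 G m → MultL1 H m′ → m′ + d ≤ m
  multiplicity-≥ (_ , bound) ((ys , ys-eigen , ys-ind) , _) =
    independent⇒≤ {P = InEigenspace1 G} bound ((extend ∘ ys) ++ twinVector)
      (++⁺ (InEigenspace1 G) (extend-eigenvector ∘ ys-eigen) twinVector-eigenvector)
      (LinIndep-++ del extension-independent (λ a j → extend-deleted (ys a) j) twinVector-pivot)
    where
    extension-independent : LinIndep (extend ∘ ys)
    extension-independent c comb≡0 =
      ys-ind c (λ i → trans (∑-cong (λ a → cong (c a *ℚ_) (≡.sym (extend-kept (ys a) i)))) (comb≡0 (emb i)))

  multiplicity : ∀ {m m′} → MultL1 G m → MultL1 H m′ → m ≡ d + m′
  multiplicity {m} {m′} mult-G mult-H =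
    ℕP.≤-antisym (multiplicity-≤ mult-G mult-H)
                 (≡.subst (_≤ m) (ℕP.+-comm m′ d) (multiplicity-≥ mult-G mult-H))

  pendants-split : p G ≡ count (isPendant G ∘ emb) + d
  pendants-split = trans (∑ℕ-split (λ v → if isPendant G v then 1 else 0))
    (cong (count (isPendant G ∘ emb) +_) (count-true (isPendant G ∘ del) (isPendant-true G ∘ del-pendant)))

  adjacentKeptPendant : Fin n → Fin k → Bool
  adjacentKeptPendant v i = adj G v (emb i) ∧ isPendant G (emb i)

  adjacentKeptPendant-sound : ∀ {v i} → adjacentKeptPendant v i ≡ true →
    adj G v (emb i) ≡ true × Pendant G (emb i)
  adjacentKeptPendant-sound {v} {i} eq =
    BoolP.∧-conicalˡ _ _ eq , isPendant-sound G (BoolP.∧-conicalʳ (adj G v (emb i)) _ eq)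

  count-adjacentKeptPendant : ∀ v → count (adjacentKeptPendant v) ≡ (if isQuasiPendant G v then 1 else 0)
  count-adjacentKeptPendant v with isQuasiPendant G v in qp
  ... | true with one-left v (isQuasiPendant-sound G qp)
  ...   | _ , (vw , w-pendant , i₀ , refl) , unique =
    count-unique (adjacentKeptPendant v) i₀ (cong₂ _∧_ vw (isPendant-true G w-pendant)) (λ i eq →
      let vi , i-pendant = adjacentKeptPendant-sound eq in emb-inj (unique (emb i) vi i-pendant (i , refl)))
  count-adjacentKeptPendant v | false = count-false (adjacentKeptPendant v) none
    where
    none : ∀ i → adjacentKeptPendant v i ≡ false
    none i with adjacentKeptPendant v i in eq
    ... | false = refl
    ... | true  = let vi , i-pendant = adjacentKeptPendant-sound eq
                  in contradiction (trans (≡.sym qp) (isQuasiPendant-complete G (emb i , vi , i-pendant))) λ ()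

  count-adjacentKeptPendant′ : ∀ i →
    count (λ v → adjacentKeptPendant v i) ≡ (if isPendant G (emb i) then 1 else 0)
  count-adjacentKeptPendant′ i = byPendancy (degree G (emb i) ℕP.≟ 1)
    where
    open ≡-Reasoning
    byPendancy : Dec (Pendant G (emb i)) →
      count (λ v → adjacentKeptPendant v i) ≡ (if isPendant G (emb i) then 1 else 0)
    byPendancy (yes pend) = begin
      count (λ v → adjacentKeptPendant v i)  ≡⟨ ∑ℕ-cong (λ v → cong (if_then 1 else 0) (adjacent v)) ⟩
      degree G (emb i)                       ≡⟨ pend ⟩
      1                                      ≡⟨ cong (if_then 1 else 0) (isPendant-true G pend) ⟨
      (if isPendant G (emb i) then 1 else 0) ∎
      where
      adjacent : ∀ v → adjacentKeptPendant v i ≡ adj G (emb i) v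
      adjacent v = trans (cong (adj G v (emb i) ∧_) (isPendant-true G pend))
                         (trans (BoolP.∧-identityʳ (adj G v (emb i))) (Graph.sym G v (emb i)))
    byPendancy (no ¬pend) =
      trans (count-false _ nonadjacent) (cong (if_then 1 else 0) (≡.sym (isPendant-false G ¬pend)))
      where
      nonadjacent : ∀ v → adjacentKeptPendant v i ≡ false
      nonadjacent v = trans (cong (adj G v (emb i) ∧_) (isPendant-false G ¬pend)) (BoolP.∧-zeroʳ (adj G v (emb i)))

  quasiPendants-count : q G ≡ count (isPendant G ∘ emb)
  quasiPendants-count = begin
    q G
      ≡⟨ ∑ℕ-cong (≡.sym ∘ count-adjacentKeptPendant) ⟩
    ∑ℕ (λ v → count (adjacentKeptPendant v))
      ≡⟨ ∑ℕ-comm (λ v i → if adjacentKeptPendant v i then 1 else 0) ⟩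
    ∑ℕ (λ i → count (λ v → adjacentKeptPendant v i))
      ≡⟨ ∑ℕ-cong count-adjacentKeptPendant′ ⟩
    count (isPendant G ∘ emb) ∎
    where open ≡-Reasoning

  d≡p∸q : d ≡ p G ∸ q G
  d≡p∸q = ≡.sym (begin
    p G ∸ q G           ≡⟨ cong₂ _∸_ pendants-split quasiPendants-count ⟩
    keptPendants + d ∸ keptPendants ≡⟨ ℕP.m+n∸m≡n keptPendants d ⟩
    d                   ∎)
    where
    open ≡-Reasoning
    keptPendants : ℕ
    keptPendants = count (isPendant G ∘ emb)

theorem1p1 : (n : ℕ) → 4 ≤ n → (G : Graph n) →
    (k : ℕ) → (Gr : Graph k) → IsReducedGraphOf Gr G →
    (m m' : ℕ) → MultL1 G m → MultL1 Gr m' →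
    m ≡ (p G ∸ q G) + m'
theorem1p1 n _ G k Gr reduced m m′ mult-G mult-Gr = trans (multiplicity mult-G mult-Gr) (cong (_+ m′) d≡p∸q)
  where open Reduced reduced
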